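{- There are no positive integers $n,g,h$ with $g\ge h$ satisfying both $\binom{n}{g} > n^h$ and $g > \sqrt{n(g-h)}$.
   Context: $\binom{n}{g}$ is the binomial coefficient (equal to $0$ if $g>n$). -}

module Defs where

{-# OPTIONS --safe #-}
module Submission where

open import Defs
open import Data.Nat using (ℕ; _*_; _∸_; _^_; _≤_; _<_; _≥_; _>_)
open import Data.Nat.Combinatorics using (_C_)
open import Data.Product using (_×_)
open import Relation.Nullary using (¬_)

open import Data.Nat.Base using (zero; suc; _+_; _!; z≤n; NonZero; >-nonZero)
open import Data.Nat.Properties
open import Data.Nat.Combinatorics using (nCk≡n!/k![n-k]!; nCk≡nC[n∸k]; k>n⇒nCk≡0; k![n∸k]!∣n!)
open import Data.Nat.DivMod using (_/_; m/n*n≡m)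
open import Data.Nat.Tactic.RingSolver using (solve-∀)
open import Data.Product using (_,_)
open import Data.Sum using (inj₁; inj₂)
open import Relation.Binary.PropositionalEquality using (_≡_; refl; sym; trans; cong; subst; subst₂; module ≡-Reasoning)

-- Write n = g + m and g = h + k. Then C(n,g)·g! = (m+1)(m+2)⋯(m+g), whose top h factors
-- are at most n^h, so it suffices that (m+1)⋯(m+k) ≤ g!. When g ≤ m the hypothesis reads
-- km < gh; this forces k < h and m + k² ≤ h² + h, so every factor m + i (i ≤ k) is at most
-- the product (h+1−i)(h+i) of two factors of g!. When m < g we swap g and m: both
-- C(n,g) and g² − n(g−h) are invariant under g ↦ n − g. Then either m ≤ h, and
-- C(n,m) ≤ n^m ≤ n^h, or the first case applies to m.

rising : ℕ → ℕ → ℕ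
rising m zero    = 1
rising m (suc j) = (suc j + m) * rising m j

[j+m]!≡rising*m! : ∀ m j → (j + m) ! ≡ rising m j * m !
[j+m]!≡rising*m! m zero    = sym (+-identityʳ (m !))
[j+m]!≡rising*m! m (suc j) = begin
  suc (j + m) * (j + m) !          ≡⟨ cong (suc (j + m) *_) ([j+m]!≡rising*m! m j) ⟩
  suc (j + m) * (rising m j * m !) ≡⟨ *-assoc (suc (j + m)) (rising m j) (m !) ⟨
  rising m (suc j) * m !           ∎
  where open ≡-Reasoning

[g+m]Cg*g!≡rising : ∀ g m → ((g + m) C g) * g ! ≡ rising m g
[g+m]Cg*g!≡rising g m = *-cancelʳ-≡ _ _ (m !) {{m !≢0}} (begin
  ((g + m) C g) * g ! * m !                 ≡⟨ *-assoc ((g + m) C g) (g !) (m !) ⟩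
  ((g + m) C g) * (g ! * m !)               ≡⟨ cong (λ x → ((g + m) C g) * (g ! * x !)) (m+n∸m≡n g m) ⟨
  ((g + m) C g) * (g ! * (g + m ∸ g) !)     ≡⟨ cong (_* (g ! * (g + m ∸ g) !)) (nCk≡n!/k![n-k]! g≤n) ⟩
  (g + m) ! / (g ! * (g + m ∸ g) !) * (g ! * (g + m ∸ g) !)
                                          ≡⟨ m/n*n≡m (k![n∸k]!∣n! g≤n) ⟩
  (g + m) !                               ≡⟨ [j+m]!≡rising*m! m g ⟩
  rising m g * m !                        ∎)
  where
  open ≡-Reasoning
  instance _ = g !* (g + m ∸ g) !≢0
  g≤n : g ≤ g + m
  g≤n = m≤m+n g m

rising-+ : ∀ m h k → rising m (h + k) ≡ rising (k + m) h * rising m k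
rising-+ m zero    k = sym (+-identityʳ (rising m k))
rising-+ m (suc h) k = begin
  suc (h + k + m) * rising m (h + k)               ≡⟨ cong (suc (h + k + m) *_) (rising-+ m h k) ⟩
  suc (h + k + m) * (rising (k + m) h * rising m k) ≡⟨ *-assoc (suc (h + k + m)) (rising (k + m) h) (rising m k) ⟨
  suc (h + k + m) * rising (k + m) h * rising m k   ≡⟨ cong (λ x → suc x * rising (k + m) h * rising m k) (+-assoc h k m) ⟩
  rising (k + m) (suc h) * rising m k               ∎
  where open ≡-Reasoning

rising≤^ : ∀ m j → rising m j ≤ (j + m) ^ j
rising≤^ m zero    = ≤-refl
rising≤^ m (suc j) = *-monoʳ-≤ (suc j + m) (≤-trans (rising≤^ m j) (^-monoˡ-≤ j (n≤1+n (j + m))))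

[g+m]Cg≤[g+m]^g : ∀ g m → (g + m) C g ≤ (g + m) ^ g
[g+m]Cg≤[g+m]^g g m = *-cancelʳ-≤ _ _ (g !) {{g !≢0}} (begin
  ((g + m) C g) * g ! ≡⟨ [g+m]Cg*g!≡rising g m ⟩
  rising m g        ≤⟨ rising≤^ m g ⟩
  (g + m) ^ g       ≤⟨ m≤m*n ((g + m) ^ g) (g !) {{g !≢0}} ⟩
  (g + m) ^ g * g ! ∎)
  where open ≤-Reasoning

rising≤!⇒[g+m]Cg≤[g+m]^h : ∀ h k m → rising m k ≤ (h + k) ! → (h + k + m) C (h + k) ≤ (h + k + m) ^ h
rising≤!⇒[g+m]Cg≤[g+m]^h h k m rising≤g! = *-cancelʳ-≤ _ _ ((h + k) !) {{(h + k) !≢0}} (begin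
  ((h + k + m) C (h + k)) * (h + k) ! ≡⟨ [g+m]Cg*g!≡rising (h + k) m ⟩
  rising m (h + k)                  ≡⟨ rising-+ m h k ⟩
  rising (k + m) h * rising m k     ≤⟨ *-mono-≤ (rising≤^ (k + m) h) rising≤g! ⟩
  (h + (k + m)) ^ h * (h + k) !     ≡⟨ cong (λ x → x ^ h * (h + k) !) (+-assoc h k m) ⟨
  (h + k + m) ^ h * (h + k) !       ∎)
  where open ≤-Reasoning

-- With h = k + d, (h + k)! / d! is the product of the pairs (d + i)(h + k + 1 − i), 1 ≤ i ≤ k.
-- The hypothesis says m + k ≤ (d + 1)(h + k); the induction peels off this outermost pair,
-- passing to (k − 1, d + 1), which leaves h unchanged.
rising*!≤! : ∀ m k d → m + k * k ≤ (k + d) * (k + d) + (k + d) → rising m k * d ! ≤ (k + d + k) !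
rising*!≤! m zero    d _    = ≤-reflexive (trans (+-identityʳ (d !)) (cong _! (sym (+-identityʳ d))))
rising*!≤! m (suc k) d cond = begin
  (suc k + m) * rising m k * d !             ≡⟨ *-assoc (suc k + m) (rising m k) (d !) ⟩
  (suc k + m) * (rising m k * d !)           ≤⟨ *-monoˡ-≤ (rising m k * d !) factor≤pair ⟩
  suc x * suc d * (rising m k * d !)         ≡⟨ regroup (suc x) (suc d) (rising m k) (d !) ⟩
  suc x * (rising m k * (suc d * d !))       ≤⟨ *-monoʳ-≤ (suc x) (rising*!≤! m k (suc d) cond′) ⟩
  suc x * x !                                ≡⟨ cong _! (suc-x k d) ⟩
  (suc k + d + suc k) !                      ∎
  where
  open ≤-Reasoning
  x : ℕ
  x = k + suc d + k

  regroup : ∀ a b c e → a * b * (c * e) ≡ a * (c * (b * e))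
  regroup = solve-∀

  suc-x : ∀ k d → suc (k + suc d + k) ≡ suc k + d + suc k
  suc-x = solve-∀

  rotate : ∀ a b c → a + b + c ≡ b + c + a
  rotate = solve-∀

  pair-excess : ∀ k d → (suc k + d) * (suc k + d) + (suc k + d) + suc k ≡ suc (k + suc d + k) * suc d + suc k * suc k
  pair-excess = solve-∀

  factor≤pair : suc k + m ≤ suc x * suc d
  factor≤pair = +-cancelʳ-≤ (suc k * suc k) (suc k + m) (suc x * suc d) (begin
    suc k + m + suc k * suc k                          ≡⟨ rotate (suc k) m (suc k * suc k) ⟩
    m + suc k * suc k + suc k                          ≤⟨ +-monoˡ-≤ (suc k) cond ⟩
    (suc k + d) * (suc k + d) + (suc k + d) + suc k    ≡⟨ pair-excess k d ⟩
    suc x * suc d + suc k * suc k                      ∎)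

  cond′ : m + k * k ≤ (k + suc d) * (k + suc d) + (k + suc d)
  cond′ = begin
    m + k * k                                    ≤⟨ +-monoʳ-≤ m (*-mono-≤ (n≤1+n k) (n≤1+n k)) ⟩
    m + suc k * suc k                            ≤⟨ cond ⟩
    (suc k + d) * (suc k + d) + (suc k + d)      ≡⟨ cong (λ y → y * y + y) (+-suc k d) ⟨
    (k + suc d) * (k + suc d) + (k + suc d)      ∎

-- k³ − 1 = (k − 1)(k² + k + 1) ≤ (k − 1)h², as k² + k + 1 ≤ h².
k³+h²≤kh²+1 : ∀ k h → .{{NonZero k}} → k < h → k * k * k + h * h ≤ k * (h * h) + 1
k³+h²≤kh²+1 k@(suc a) h k<h = begin
  k * k * k + h * h              ≡⟨ cube-split a h ⟩
  a * (k * k + k + 1) + (h * h + 1)  ≤⟨ +-monoˡ-≤ (h * h + 1) (*-monoʳ-≤ a k²+k+1≤h²) ⟩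
  a * (h * h) + (h * h + 1)      ≡⟨ regroup a h ⟩
  k * (h * h) + 1                ∎
  where
  open ≤-Reasoning
  cube-split : ∀ a h → suc a * suc a * suc a + h * h ≡ a * (suc a * suc a + suc a + 1) + (h * h + 1)
  cube-split = solve-∀

  regroup : ∀ a h → a * (h * h) + (h * h + 1) ≡ suc a * (h * h) + 1
  regroup = solve-∀

  square-suc : ∀ k → k * k + k + 1 + k ≡ suc k * suc k
  square-suc = solve-∀

  k²+k+1≤h² : k * k + k + 1 ≤ h * h
  k²+k+1≤h² = begin
    k * k + k + 1      ≤⟨ m≤m+n (k * k + k + 1) k ⟩
    k * k + k + 1 + k  ≡⟨ square-suc k ⟩
    suc k * suc k      ≤⟨ *-mono-≤ k<h k<h ⟩
    h * h              ∎

g≤m⇒k<h : ∀ h k m → h + k ≤ m → k * m < (h + k) * h → k < h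
g≤m⇒k<h h k m g≤m km<gh = *-cancelˡ-< (h + k) k h (begin-strict
  (h + k) * k   ≡⟨ *-comm (h + k) k ⟩
  k * (h + k)   ≤⟨ *-monoʳ-≤ k g≤m ⟩
  k * m         <⟨ km<gh ⟩
  (h + k) * h   ∎)
  where open ≤-Reasoning

km<gh⇒m+k²≤h²+h : ∀ m k h → .{{NonZero k}} → k < h → k * m < (h + k) * h → m + k * k ≤ h * h + h
km<gh⇒m+k²≤h²+h m k h k<h km<gh = *-cancelˡ-≤ k (+-cancelʳ-≤ (1 + h * h) _ _ (begin
  k * (m + k * k) + (1 + h * h)      ≡⟨ expand k m h ⟩
  suc (k * m) + (k * k * k + h * h)  ≤⟨ +-mono-≤ km<gh (k³+h²≤kh²+1 k h k<h) ⟩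
  (h + k) * h + (k * (h * h) + 1)    ≡⟨ collect k h ⟩
  k * (h * h + h) + (1 + h * h)      ∎))
  where
  open ≤-Reasoning
  expand : ∀ k m h → k * (m + k * k) + (1 + h * h) ≡ suc (k * m) + (k * k * k + h * h)
  expand = solve-∀

  collect : ∀ k h → (h + k) * h + (k * (h * h) + 1) ≡ k * (h * h + h) + (1 + h * h)
  collect = solve-∀

rising≤! : ∀ h k m → k < h → k * m < (h + k) * h → rising m k ≤ (h + k) !
rising≤! h zero      m _   _     = 1≤n! (h + zero)
rising≤! h k@(suc _) m k<h km<gh with m≤n⇒∃[o]m+o≡n (<⇒≤ k<h)
... | d , refl = begin
  rising m k        ≤⟨ m≤m*n (rising m k) (d !) {{d !≢0}} ⟩
  rising m k * d !  ≤⟨ rising*!≤! m k d (km<gh⇒m+k²≤h²+h m k (k + d) k<h km<gh) ⟩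
  (k + d + k) !     ∎
  where open ≤-Reasoning

g≤m⇒[g+m]Cg≤[g+m]^h : ∀ h k m → h + k ≤ m → (h + k + m) * k < (h + k) * (h + k) →
                       (h + k + m) C (h + k) ≤ (h + k + m) ^ h
g≤m⇒[g+m]Cg≤[g+m]^h h k m g≤m cond =
  rising≤!⇒[g+m]Cg≤[g+m]^h h k m (rising≤! h k m (g≤m⇒k<h h k m g≤m km<gh) km<gh)
  where
  split-k : ∀ h k m → (h + k + m) * k ≡ k * m + (h + k) * k
  split-k = solve-∀

  split-g : ∀ h k → (h + k) * (h + k) ≡ (h + k) * h + (h + k) * k
  split-g = solve-∀

  km<gh : k * m < (h + k) * h
  km<gh = +-cancelʳ-< ((h + k) * k) (k * m) ((h + k) * h) (subst₂ _<_ (split-k h k m) (split-g h k) cond)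

n[g∸h]<g²⇒n[m∸h]<m² : ∀ h k k′ → (h + k + (h + k′)) * k < (h + k) * (h + k) →
                       (h + k′ + (h + k)) * k′ < (h + k′) * (h + k′)
n[g∸h]<g²⇒n[m∸h]<m² h k k′ cond = +-cancelʳ-< ((h + k) * (h + k)) _ _ (begin-strict
  (h + k′ + (h + k)) * k′ + (h + k) * (h + k)  ≡⟨ symmetric-excess h k k′ ⟩
  (h + k′) * (h + k′) + (h + k + (h + k′)) * k <⟨ +-monoʳ-< ((h + k′) * (h + k′)) cond ⟩
  (h + k′) * (h + k′) + (h + k) * (h + k)      ∎)
  where
  open ≤-Reasoning
  symmetric-excess : ∀ h k k′ → (h + k′ + (h + k)) * k′ + (h + k) * (h + k) ≡ (h + k′) * (h + k′) + (h + k + (h + k′)) * k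
  symmetric-excess = solve-∀

[a+b]Ca≡[b+a]Cb : ∀ a b → (a + b) C a ≡ (b + a) C b
[a+b]Ca≡[b+a]Cb a b = begin
  (a + b) C a            ≡⟨ nCk≡nC[n∸k] (m≤m+n a b) ⟩
  (a + b) C (a + b ∸ a)  ≡⟨ cong ((a + b) C_) (m+n∸m≡n a b) ⟩
  (a + b) C b            ≡⟨ cong (_C b) (+-comm a b) ⟩
  (b + a) C b            ∎
  where open ≡-Reasoning

[g+m]Cg≤[g+m]^h : ∀ h k m → (h + k + m) * k < (h + k) * (h + k) → (h + k + m) C (h + k) ≤ (h + k + m) ^ h
[g+m]Cg≤[g+m]^h h k m cond with ≤-<-connex (h + k) m
... | inj₁ g≤m = g≤m⇒[g+m]Cg≤[g+m]^h h k m g≤m cond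
... | inj₂ m<g with ≤-<-connex m h
...   | inj₁ m≤h = begin
  (h + k + m) C (h + k)  ≡⟨ [a+b]Ca≡[b+a]Cb (h + k) m ⟩
  (m + (h + k)) C m      ≤⟨ [g+m]Cg≤[g+m]^g m (h + k) ⟩
  (m + (h + k)) ^ m      ≡⟨ cong (_^ m) (+-comm m (h + k)) ⟩
  (h + k + m) ^ m        ≤⟨ ^-monoʳ-≤ (h + k + m) {{n≢0}} m≤h ⟩
  (h + k + m) ^ h        ∎
  where
  open ≤-Reasoning
  n≢0 : NonZero (h + k + m)
  n≢0 = >-nonZero (<-≤-trans (≤-<-trans z≤n m<g) (m≤m+n (h + k) m))
...   | inj₂ h<m with m≤n⇒∃[o]m+o≡n (<⇒≤ h<m)
...     | k′ , refl = begin
  (h + k + (h + k′)) C (h + k)  ≡⟨ [a+b]Ca≡[b+a]Cb (h + k) (h + k′) ⟩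
  (h + k′ + (h + k)) C (h + k′) ≤⟨ g≤m⇒[g+m]Cg≤[g+m]^h h k′ (h + k) (<⇒≤ m<g) (n[g∸h]<g²⇒n[m∸h]<m² h k k′ cond) ⟩
  (h + k′ + (h + k)) ^ h        ≡⟨ cong (_^ h) (+-comm (h + k′) (h + k)) ⟩
  (h + k + (h + k′)) ^ h        ∎
  where open ≤-Reasoning

nCg≤n^h : ∀ n g h → h ≤ g → n * (g ∸ h) < g * g → n C g ≤ n ^ h
nCg≤n^h n g h h≤g cond with ≤-<-connex g n
... | inj₂ n<g = ≤-trans (≤-reflexive (k>n⇒nCk≡0 n<g)) z≤n
... | inj₁ g≤n with m≤n⇒∃[o]m+o≡n g≤n | m≤n⇒∃[o]m+o≡n h≤g
...   | m , refl | k , refl =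
  [g+m]Cg≤[g+m]^h h k m (subst (λ x → (h + k + m) * x < (h + k) * (h + k)) (m+n∸m≡n h k) cond)

mainTheorem4 : (n g h : ℕ) → n > 0 → g > 0 → h > 0 → g ≥ h →
    ¬ ((n C g > n ^ h) × (g * g > n * (g ∸ h)))
mainTheorem4 n g h _ _ _ g≥h (nCg>n^h , g²>n[g∸h]) = <⇒≱ nCg>n^h (nCg≤n^h n g h g≥h g²>n[g∸h])
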